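{- Let $G$ be a bridgeless cubic graph with $\tau(G)=4$. Then $G$ has an odd covering of size $5$.
   Context: For a bridgeless cubic graph $G$, $\tau(G)$ is the minimum number of perfect matchings of $G$ whose union is $E(G)$. An odd covering of $G$ is a finite list (repetitions allowed) of perfect matchings of $G$ such that every edge of $G$ is contained in an odd number of members of the list; its size is the number of members of the list. -}

module Defs where

open import Data.Nat using (ℕ; zero; suc; _%_)
open import Data.Fin using (Fin; _≟_)
open import Data.Fin.Subset using (Subset; _∈_)
open import Data.Fin.Subset.Properties using (_∈?_)
open import Data.Product using (Σ; _×_; _,_; proj₁; proj₂)
open import Data.Sum using (_⊎_)
open import Data.List using (List; length; filter)
open import Data.List.Base using (allFin)
open import Data.Vec using (Vec; lookup)
open import Relation.Binary.PropositionalEquality using (_≡_; _≢_)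
open import Relation.Nullary using (¬_; Dec)
open import Relation.Nullary.Decidable using (_⊎-dec_)
open import Relation.Unary using (Decidable)

record Graph : Set where
  field
    n    : ℕ
    m    : ℕ
    ends : Fin m → Fin n × Fin n
    loopless : (e : Fin m) → proj₁ (ends e) ≢ proj₂ (ends e)
open Graph public

Incident : (G : Graph) → Fin (m G) → Fin (n G) → Set
Incident G e v = (proj₁ (ends G e) ≡ v) ⊎ (proj₂ (ends G e) ≡ v)

incident? : (G : Graph) (v : Fin (n G)) → Decidable (λ e → Incident G e v)
incident? G v e = (proj₁ (ends G e) ≟ v) ⊎-dec (proj₂ (ends G e) ≟ v)

-- degree of a vertex (no loops, so number of incident edges)
degree : (G : Graph) → Fin (n G) → ℕ
degree G v = length (filter (incident? G v) (allFin (m G)))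

Cubic : Graph → Set
Cubic G = (v : Fin (n G)) → degree G v ≡ 3

Joins : (G : Graph) → Fin (m G) → Fin (n G) → Fin (n G) → Set
Joins G e u w = (ends G e ≡ (u , w)) ⊎ (ends G e ≡ (w , u))

data ConnAvoiding (G : Graph) (d : Fin (m G)) : Fin (n G) → Fin (n G) → Set where
  here : ∀ {u} → ConnAvoiding G d u u
  step : ∀ {u w v} (e : Fin (m G)) → e ≢ d → Joins G e u w →
         ConnAvoiding G d w v → ConnAvoiding G d u v

IsBridge : (G : Graph) → Fin (m G) → Set
IsBridge G d = ¬ ConnAvoiding G d (proj₁ (ends G d)) (proj₂ (ends G d))

Bridgeless : Graph → Set
Bridgeless G = (d : Fin (m G)) → ¬ IsBridge G d

PerfectMatching : (G : Graph) → Subset (m G) → Set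
PerfectMatching G M =
  (v : Fin (n G)) → Σ (Fin (m G)) λ e → (e ∈ M) × Incident G e v ×
    ((e' : Fin (m G)) → e' ∈ M → Incident G e' v → e' ≡ e)

PMCover : (G : Graph) (k : ℕ) → Set
PMCover G k = Σ (Vec (Subset (m G)) k) λ Ms →
  ((i : Fin k) → PerfectMatching G (lookup Ms i)) ×
  ((e : Fin (m G)) → Σ (Fin k) λ i → e ∈ lookup Ms i)

TauEq : Graph → ℕ → Set
TauEq G t = PMCover G t × ((k : ℕ) → k Data.Nat.< t → ¬ PMCover G k)

multiplicity : (G : Graph) {k : ℕ} → Vec (Subset (m G)) k → Fin (m G) → ℕ
multiplicity G {k} Ms e = length (filter (λ i → e ∈? lookup Ms i) (allFin k))

OddCovering : (G : Graph) (k : ℕ) → Set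
OddCovering G k = Σ (Vec (Subset (m G)) k) λ Ms →
  ((i : Fin k) → PerfectMatching G (lookup Ms i)) ×
  ((e : Fin (m G)) → multiplicity G Ms e % 2 ≡ 1)

module Submission where

-- Let M₀,…,M₃ be perfect matchings covering E(G) (they exist since
-- τ(G) = 4) and let μ(e) be the number of them containing the edge e.  At a
-- vertex v of the cubic graph G, with incident edges a, b, c, each perfect
-- matching contains exactly one of a, b, c, so μ(a) + μ(b) + μ(c) = 4; since
-- the matchings cover E(G), every μ is at least 1.  Hence exactly one edge at v
-- has multiplicity 2 and the other two have multiplicity 1.  Consequently
-- (i) every edge has multiplicity 1 or 2, and (ii) the set D of edges of
-- multiplicity 2 is itself a perfect matching.  The list D, M₀, …, M₃ is then
-- an odd covering of size 5: edges outside D are covered once, edges of D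
-- three times.

open import Defs
open import Data.Nat using (ℕ; suc; _+_; _≤_; s≤s; z≤n; _%_)
import Data.Nat as ℕ
open import Data.Nat.Properties using (≤-trans; m≤n+m; suc-injective)
open import Data.Nat.Tactic.RingSolver using (solve-∀)
open import Data.Bool using (true; false; if_then_else_)
open import Data.Fin using (Fin; _≟_) renaming (zero to fzero; suc to fsuc)
open import Data.Fin.Subset using (Subset; _∈_; _∉_)
open import Data.Fin.Subset.Properties using (_∈?_)
open import Data.Product using (Σ; _×_; _,_; proj₁; proj₂)
open import Data.Sum using (_⊎_; inj₁; inj₂; [_,_]′)
open import Data.List using (List; []; _∷_; length; filter; map; tabulate)
open import Data.List.Base using (allFin)
open import Data.List.Properties using (map-tabulate)
open import Data.List.Relation.Unary.All using ([]; _∷_)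
open import Data.List.Relation.Unary.AllPairs using ([]; _∷_)
open import Data.List.Relation.Unary.Unique.Propositional using (Unique)
import Data.List.Relation.Unary.Unique.Propositional.Properties as Unique
open import Data.List.Relation.Unary.Any using (here; there)
import Data.List.Membership.Propositional as List
open import Data.List.Membership.Propositional.Properties using (∈-filter⁺; ∈-filter⁻; ∈-allFin)
open import Data.Vec using (Vec; []; _∷_; lookup)
import Data.Vec as Vec
open import Data.Vec.Properties using ([]=⇒lookup; lookup⇒[]=; lookup∘tabulate)
open import Data.Empty using (⊥-elim)
open import Function using (_∘_; id)
open import Relation.Binary.PropositionalEquality
  using (_≡_; _≢_; refl; sym; trans; cong; cong₂; subst; module ≡-Reasoning)
open import Relation.Nullary using (yes; no; does)
open import Relation.Nullary.Decidable using (dec-true; decidable-stable)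
open import Relation.Unary using (Pred; Decidable)

indicator : ∀ {k} → Fin k → Subset k → ℕ
indicator e M = if does (e ∈? M) then 1 else 0

indicator-∈ : ∀ {k} {e : Fin k} {M} → e ∈ M → indicator e M ≡ 1
indicator-∈ {e = e} {M} e∈M with e ∈? M
... | yes _   = refl
... | no e∉M = ⊥-elim (e∉M e∈M)

indicator-∉ : ∀ {k} {e : Fin k} {M} → e ∉ M → indicator e M ≡ 0
indicator-∉ {e = e} {M} e∉M with e ∈? M
... | yes e∈M = ⊥-elim (e∉M e∈M)
... | no _    = refl

count-map : ∀ {a b p} {A : Set a} {B : Set b} {P : Pred B p} (P? : Decidable P)
  (g : A → B) (xs : List A) →
  length (filter P? (map g xs)) ≡ length (filter (P? ∘ g) xs)
count-map P? g [] = refl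
count-map P? g (x ∷ xs) with does (P? (g x))
... | true  = cong suc (count-map P? g xs)
... | false = count-map P? g xs

count-∷ : ∀ {a p} {A : Set a} {P : Pred A p} (P? : Decidable P) (x : A) (xs : List A) →
  length (filter P? (x ∷ xs)) ≡ (if does (P? x) then 1 else 0) + length (filter P? xs)
count-∷ P? x xs with does (P? x)
... | true  = refl
... | false = refl

multiplicity-∷ : (G : Graph) {k : ℕ} (M : Subset (m G)) (Ms : Vec (Subset (m G)) k)
  (e : Fin (m G)) →
  multiplicity G (M ∷ Ms) e ≡ indicator e M + multiplicity G Ms e
multiplicity-∷ G {k} M Ms e = begin
  length (filter P? (fzero ∷ tabulate fsuc))
    ≡⟨ count-∷ P? fzero (tabulate fsuc) ⟩
  indicator e M + length (filter P? (tabulate fsuc))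
    ≡⟨ cong (λ is → indicator e M + length (filter P? is)) (sym (map-tabulate id fsuc)) ⟩
  indicator e M + length (filter P? (map fsuc (allFin k)))
    ≡⟨ cong (indicator e M +_) (count-map P? fsuc (allFin k)) ⟩
  indicator e M + multiplicity G Ms e ∎
  where
  open ≡-Reasoning
  P? = λ i → e ∈? lookup (M ∷ Ms) i

multiplicity-∈ : (G : Graph) {k : ℕ} (Ms : Vec (Subset (m G)) k) (i : Fin k)
  {e : Fin (m G)} → e ∈ lookup Ms i → 1 ≤ multiplicity G Ms e
multiplicity-∈ G (M ∷ Ms) fzero {e} e∈M
  rewrite multiplicity-∷ G M Ms e | indicator-∈ e∈M = s≤s z≤n
multiplicity-∈ G (M ∷ Ms) (fsuc i) {e} e∈Ms
  rewrite multiplicity-∷ G M Ms e =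
  ≤-trans (multiplicity-∈ G Ms i e∈Ms) (m≤n+m _ (indicator e M))

⟦_⟧ : ∀ {k p} {P : Pred (Fin k) p} → Decidable P → Subset k
⟦ P? ⟧ = Vec.tabulate (λ x → does (P? x))

∈⟦⟧⁺ : ∀ {k p} {P : Pred (Fin k) p} (P? : Decidable P) {x} → P x → x ∈ ⟦ P? ⟧
∈⟦⟧⁺ P? {x} px =
  lookup⇒[]= x ⟦ P? ⟧ (trans (lookup∘tabulate (λ y → does (P? y)) x) (dec-true (P? x) px))

∈⟦⟧⁻ : ∀ {k p} {P : Pred (Fin k) p} (P? : Decidable P) {x} → x ∈ ⟦ P? ⟧ → P x
∈⟦⟧⁻ P? {x} x∈ with P? x | trans (sym (lookup∘tabulate (λ y → does (P? y)) x)) ([]=⇒lookup x∈)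
... | yes px | _  = px
... | no _   | ()

record Star (G : Graph) (v : Fin (n G)) : Set where
  field
    a b c    : Fin (m G)
    a-at     : Incident G a v
    b-at     : Incident G b v
    c-at     : Incident G c v
    a≢b      : a ≢ b
    a≢c      : a ≢ c
    b≢c      : b ≢ c
    only-abc : ∀ e → Incident G e v → (e ≡ a) ⊎ (e ≡ b) ⊎ (e ≡ c)

-- A vertex of degree three has a star: its edges are the (duplicate-free)
-- list of incident edges, which has length three.
star : (G : Graph) (v : Fin (n G)) → degree G v ≡ 3 → Star G v
star G v deg = fromList (filter (incident? G v) (allFin (m G))) deg
  (Unique.filter⁺ (incident? G v) (Unique.allFin⁺ (m G)))
  (λ e e-at → ∈-filter⁺ (incident? G v) (∈-allFin e) e-at)
  (λ e e∈ → proj₂ (∈-filter⁻ (incident? G v) {xs = allFin (m G)} e∈))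
  where
  fromList : (es : List (Fin (m G))) → length es ≡ 3 → Unique es →
    (∀ e → Incident G e v → e List.∈ es) → (∀ e → e List.∈ es → Incident G e v) →
    Star G v
  fromList (a ∷ b ∷ c ∷ []) refl ((a≢b ∷ a≢c ∷ []) ∷ (b≢c ∷ []) ∷ _) complete sound = record
    { a = a ; b = b ; c = c
    ; a-at = sound a (here refl)
    ; b-at = sound b (there (here refl))
    ; c-at = sound c (there (there (here refl)))
    ; a≢b = a≢b ; a≢c = a≢c ; b≢c = b≢c
    ; only-abc = λ e e-at → members (complete e e-at) }
    where
    members : ∀ {e} → e List.∈ (a ∷ b ∷ c ∷ []) → (e ≡ a) ⊎ (e ≡ b) ⊎ (e ≡ c)
    members (here e≡a)                 = inj₁ e≡a
    members (there (here e≡b))         = inj₂ (inj₁ e≡b)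
    members (there (there (here e≡c))) = inj₂ (inj₂ e≡c)

rotate : ∀ {G v} → Star G v → Star G v
rotate s = record
  { a = b ; b = c ; c = a
  ; a-at = b-at ; b-at = c-at ; c-at = a-at
  ; a≢b = b≢c ; a≢c = a≢b ∘ sym ; b≢c = a≢c ∘ sym
  ; only-abc = λ e e-at → [ inj₂ ∘ inj₂ , [ inj₁ , inj₂ ∘ inj₁ ]′ ]′ (only-abc e e-at) }
  where open Star s

matching-meets-star : ∀ {G v} (s : Star G v) {M} → PerfectMatching G M →
  let open Star s in indicator a M + indicator b M + indicator c M ≡ 1
matching-meets-star {G} {v} s {M} pm with pm v
... | f , f∈M , f-at , unique = meets (only-abc f f-at)
  where
  open Star s

  miss : ∀ {e} → Incident G e v → e ≢ f → indicator e M ≡ 0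
  miss e-at e≢f = indicator-∉ (λ e∈M → e≢f (unique _ e∈M e-at))

  meets : (f ≡ a) ⊎ (f ≡ b) ⊎ (f ≡ c) → indicator a M + indicator b M + indicator c M ≡ 1
  meets (inj₁ f≡a)
    rewrite indicator-∈ (subst (_∈ M) f≡a f∈M)
          | miss b-at (λ b≡f → a≢b (sym (trans b≡f f≡a)))
          | miss c-at (λ c≡f → a≢c (sym (trans c≡f f≡a))) = refl
  meets (inj₂ (inj₁ f≡b))
    rewrite indicator-∈ (subst (_∈ M) f≡b f∈M)
          | miss a-at (λ a≡f → a≢b (trans a≡f f≡b))
          | miss c-at (λ c≡f → b≢c (sym (trans c≡f f≡b))) = refl
  meets (inj₂ (inj₂ f≡c))
    rewrite indicator-∈ (subst (_∈ M) f≡c f∈M)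
          | miss a-at (λ a≡f → a≢c (trans a≡f f≡c))
          | miss b-at (λ b≡f → b≢c (trans b≡f f≡c)) = refl

star-multiplicities : ∀ {G v} (s : Star G v) {k} (Ms : Vec (Subset (m G)) k) →
  ((i : Fin k) → PerfectMatching G (lookup Ms i)) →
  let open Star s in
  multiplicity G Ms a + multiplicity G Ms b + multiplicity G Ms c ≡ k
star-multiplicities s [] pms = refl
star-multiplicities {G} s {suc k} (M ∷ Ms) pms = begin
  μ′ a + μ′ b + μ′ c
    ≡⟨ cong₂ _+_ (cong₂ _+_ (multiplicity-∷ G M Ms a) (multiplicity-∷ G M Ms b))
                 (multiplicity-∷ G M Ms c) ⟩
  (indicator a M + μ a) + (indicator b M + μ b) + (indicator c M + μ c)
    ≡⟨ interchange (indicator a M) (μ a) (indicator b M) (μ b) (indicator c M) (μ c) ⟩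
  (indicator a M + indicator b M + indicator c M) + (μ a + μ b + μ c)
    ≡⟨ cong₂ _+_ (matching-meets-star s (pms fzero)) (star-multiplicities s Ms (pms ∘ fsuc)) ⟩
  1 + k ∎
  where
  open Star s
  open ≡-Reasoning
  μ′ = multiplicity G (M ∷ Ms)
  μ  = multiplicity G Ms
  interchange : ∀ x x′ y y′ z z′ → (x + x′) + (y + y′) + (z + z′) ≡ (x + y + z) + (x′ + y′ + z′)
  interchange = solve-∀

OneDoubled : ℕ → ℕ → ℕ → Set
OneDoubled x y z = (x ≡ 2 × y ≡ 1 × z ≡ 1) ⊎ (x ≡ 1 × y ≡ 2 × z ≡ 1) ⊎ (x ≡ 1 × y ≡ 1 × z ≡ 2)

-- Positive numbers with sum 4 are 2, 1, 1 in some order: subtracting one from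
-- each leaves a sum of 1, i.e. exactly one excess of 1.
one-doubled : ∀ x y z → 1 ≤ x → 1 ≤ y → 1 ≤ z → x + y + z ≡ 4 → OneDoubled x y z
one-doubled (suc x) (suc y) (suc z) _ _ _ sum≡4 =
  excess x y z (suc-injective (suc-injective (suc-injective
    (trans (sym (shift x y z)) sum≡4))))
  where
  shift : ∀ x y z → suc x + suc y + suc z ≡ 3 + (x + y + z)
  shift = solve-∀

  excess : ∀ x y z → x + y + z ≡ 1 → OneDoubled (suc x) (suc y) (suc z)
  excess 1 0 0 refl = inj₁ (refl , refl , refl)
  excess 0 1 0 refl = inj₂ (inj₁ (refl , refl , refl))
  excess 0 0 1 refl = inj₂ (inj₂ (refl , refl , refl))
  excess 0 0 0 ()
  excess 0 0 (suc (suc z)) ()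
  excess 0 1 (suc z) ()
  excess 0 (suc (suc y)) z ()
  excess 1 0 (suc z) ()
  excess 1 (suc y) z ()
  excess (suc (suc x)) y z ()

module FourCover (G : Graph) (cubic : Cubic G) (Ms : Vec (Subset (m G)) 4)
  (perfect : (i : Fin 4) → PerfectMatching G (lookup Ms i))
  (covers : (e : Fin (m G)) → Σ (Fin 4) λ i → e ∈ lookup Ms i) where

  μ : Fin (m G) → ℕ
  μ = multiplicity G Ms

  record DoubledAt (v : Fin (n G)) : Set where
    field
      edge    : Fin (m G)
      edge-at : Incident G edge v
      twice   : μ edge ≡ 2
      once    : ∀ e → Incident G e v → e ≢ edge → μ e ≡ 1

  first-doubled : ∀ {v} (s : Star G v) → let open Star s in
    μ a ≡ 2 → μ b ≡ 1 → μ c ≡ 1 → DoubledAt v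
  first-doubled s μa≡2 μb≡1 μc≡1 = record
    { edge = a ; edge-at = a-at ; twice = μa≡2
    ; once = λ e e-at e≢a →
        [ ⊥-elim ∘ e≢a
        , [ (λ e≡b → trans (cong μ e≡b) μb≡1) , (λ e≡c → trans (cong μ e≡c) μc≡1) ]′ ]′
        (only-abc e e-at) }
    where open Star s

  from-pattern : ∀ {v} (s : Star G v) → let open Star s in
    OneDoubled (μ a) (μ b) (μ c) → DoubledAt v
  from-pattern s (inj₁ (μa≡2 , μb≡1 , μc≡1))        = first-doubled s μa≡2 μb≡1 μc≡1
  from-pattern s (inj₂ (inj₁ (μa≡1 , μb≡2 , μc≡1))) = first-doubled (rotate s) μb≡2 μc≡1 μa≡1
  from-pattern s (inj₂ (inj₂ (μa≡1 , μb≡1 , μc≡2))) =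
    first-doubled (rotate (rotate s)) μc≡2 μa≡1 μb≡1

  -- Every vertex has a doubled edge, by the star identity with k = 4 and the
  -- positivity of multiplicities.
  doubledAt : ∀ v → DoubledAt v
  doubledAt v = from-pattern s
    (one-doubled (μ a) (μ b) (μ c) (positive a) (positive b) (positive c)
                 (star-multiplicities s Ms perfect))
    where
    s = star G v (cubic v)
    open Star s
    positive : ∀ e → 1 ≤ μ e
    positive e = multiplicity-∈ G Ms (proj₁ (covers e)) (proj₂ (covers e))

  once-or-twice : ∀ e → (μ e ≡ 1) ⊎ (μ e ≡ 2)
  once-or-twice e = at (doubledAt (proj₁ (ends G e))) (inj₁ refl)
    where
    at : ∀ {v} → DoubledAt v → Incident G e v → (μ e ≡ 1) ⊎ (μ e ≡ 2)
    at d e-at with e ≟ DoubledAt.edge d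
    ... | yes e≡edge = inj₂ (trans (cong μ e≡edge) (DoubledAt.twice d))
    ... | no e≢edge  = inj₁ (DoubledAt.once d e e-at e≢edge)

  D : Subset (m G)
  D = ⟦ (λ e → μ e ℕ.≟ 2) ⟧

  twice⇒∈D : ∀ {e} → μ e ≡ 2 → e ∈ D
  twice⇒∈D = ∈⟦⟧⁺ (λ e → μ e ℕ.≟ 2)

  ∈D⇒twice : ∀ {e} → e ∈ D → μ e ≡ 2
  ∈D⇒twice = ∈⟦⟧⁻ (λ e → μ e ℕ.≟ 2)

  once⇒∉D : ∀ {e} → μ e ≡ 1 → e ∉ D
  once⇒∉D μe≡1 e∈D with trans (sym μe≡1) (∈D⇒twice e∈D)
  ... | ()

  -- D is a perfect matching: at each vertex it contains exactly the doubled edge.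
  D-perfect : PerfectMatching G D
  D-perfect v = edge , twice⇒∈D twice , edge-at , only-edge
    where
    open DoubledAt (doubledAt v)
    only-edge : ∀ e → e ∈ D → Incident G e v → e ≡ edge
    only-edge e e∈D e-at =
      decidable-stable (e ≟ edge) λ e≢edge → once⇒∉D (once e e-at e≢edge) e∈D

  -- Adding D to the cover makes every multiplicity odd: 0 + 1 or 1 + 2.
  odd-covering : OddCovering G 5
  odd-covering = D ∷ Ms , members , odd
    where
    members : (i : Fin 5) → PerfectMatching G (lookup (D ∷ Ms) i)
    members fzero    = D-perfect
    members (fsuc i) = perfect i

    odd : ∀ e → multiplicity G (D ∷ Ms) e % 2 ≡ 1
    odd e = subst (λ t → t % 2 ≡ 1) (sym (multiplicity-∷ G D Ms e)) (odd-sum (once-or-twice e))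
      where
      odd-sum : (μ e ≡ 1) ⊎ (μ e ≡ 2) → (indicator e D + μ e) % 2 ≡ 1
      odd-sum (inj₁ μe≡1) = cong (_% 2) (cong₂ _+_ (indicator-∉ {e = e} (once⇒∉D {e} μe≡1)) μe≡1)
      odd-sum (inj₂ μe≡2) = cong (_% 2) (cong₂ _+_ (indicator-∈ {e = e} (twice⇒∈D {e} μe≡2)) μe≡2)

proposition6p1 : (G : Graph) → Bridgeless G → Cubic G → TauEq G 4 → OddCovering G 5
proposition6p1 G _ cubic ((Ms , perfect , covers) , _) =
  FourCover.odd-covering G cubic Ms perfect covers
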